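{- For every integer $n\ge1$ there is a bijection $\varphi^{(B)}:\mathcal{A}^{(H)}_n\to\mathcal{RS}^{(B)}_{n-1}$ such that $\mathrm{Last}(\sigma)-1=\mathrm{Last}(\varphi^{(B)}(\sigma))$ for all $\sigma\in\mathcal{A}^{(H)}_n$. In particular, for each $k$, $\varphi^{(B)}$ restricts to a bijection from the set of elements of $\mathcal{A}^{(H)}_n$ with last entry $k$ onto the set of elements of $\mathcal{RS}^{(B)}_{n-1}$ with last entry $k-1$.
   Context: A signed permutation of $[n]$ is a sequence $\pi=\pi_1\cdots\pi_n$ of elements of $\{\pm1,\dots,\pm n\}$ such that $|\pi_1|\cdots|\pi_n|$ is a permutation of $[n]$; $\mathrm{Last}(\pi)=\pi_n$. For an ordinary permutation $\tau$ of $[n]$, $\tau_{[k]}$ is the subword of letters $1,\dots,k$ in order of appearance; a double descent is three consecutive letters $a>b>c$; ending with an ascent means the last two letters $x,y$ satisfy $x<y$. $\tau$ is André if for all $k$, $\tau_{[k]}$ has no double descents and ends with an ascent (vacuous for length 1); $\tau$ is Simsun if for all $k$, $\tau_{[k]}$ has no double descents. $\mathcal{A}^{(H)}_n$ (Hetyei's signed André permutations) is the set of signed permutations $\pi$ of $[n]$ such that $|\pi_1|\cdots|\pi_n|$ is an André permutation and $\pi_i>0$ whenever $|\pi_i|=\min\{|\pi_i|,|\pi_{i+1}|,\dots,|\pi_n|\}$. $\mathcal{RS}^{(B)}_n$ (signed Simsun permutations) is the set of signed permutations $\pi$ of $[n]$ such that $|\pi_1|\cdots|\pi_n|$ is a Simsun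 permutation and $\pi_i>0$ whenever $|\pi_i|=\min\{|\pi_i|,|\pi_{i+1}|,\dots,|\pi_n|\}$. -}

module Defs where

open import Data.Nat as ℕ using (ℕ; _≤?_)
open import Data.Integer as ℤ using (ℤ; ∣_∣; +_)
open import Data.List using (List; []; _∷_; map; filter; upTo)
open import Data.List.Relation.Unary.All using (All)
open import Data.List.Relation.Binary.Permutation.Propositional using (_↭_)
open import Data.Product using (_×_)
open import Data.Unit using (⊤)
open import Relation.Nullary using (¬_)

oneTo : ℕ → List ℕ
oneTo n = map ℕ.suc (upTo n)

IsPerm : ℕ → List ℕ → Set
IsPerm n τ = τ ↭ oneTo n

IsSignedPerm : ℕ → List ℤ → Set
IsSignedPerm n π = IsPerm n (map ∣_∣ π)

restrict : ℕ → List ℕ → List ℕ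
restrict k τ = filter (_≤? k) τ

NoDoubleDescent : List ℕ → Set
NoDoubleDescent (a ∷ b ∷ c ∷ rest) =
  ¬ (b ℕ.< a × c ℕ.< b) × NoDoubleDescent (b ∷ c ∷ rest)
NoDoubleDescent _ = ⊤

EndsWithAscent : List ℕ → Set
EndsWithAscent (x ∷ y ∷ []) = x ℕ.< y
EndsWithAscent (x ∷ y ∷ z ∷ rest) = EndsWithAscent (y ∷ z ∷ rest)
EndsWithAscent _ = ⊤

IsAndre : List ℕ → Set
IsAndre τ = ∀ k → NoDoubleDescent (restrict k τ) × EndsWithAscent (restrict k τ)

IsSimsun : List ℕ → Set
IsSimsun τ = ∀ k → NoDoubleDescent (restrict k τ)

SignCondition : List ℤ → Set
SignCondition [] = ⊤
SignCondition (x ∷ xs) =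
  (All (λ y → ∣ x ∣ ℕ.≤ ∣ y ∣) xs → ℤ.0ℤ ℤ.< x) × SignCondition xs

SignedAndre : ℕ → List ℤ → Set
SignedAndre n π = IsSignedPerm n π × IsAndre (map ∣_∣ π) × SignCondition π

SignedSimsun : ℕ → List ℤ → Set
SignedSimsun n π = IsSignedPerm n π × IsSimsun (map ∣_∣ π) × SignCondition π

-- Last(π) = π_n; convention Last(empty word) = 0
Last : List ℤ → ℤ
Last [] = ℤ.0ℤ
Last (x ∷ []) = x
Last (x ∷ y ∷ xs) = Last (y ∷ xs)

-- Both families are built by inserting the letter of largest absolute value: every
-- signed permutation of [m+1] is ins i v s with ∣v∣ = m+1 and s a signed permutation
-- of [m].  Since the André and Simsun conditions are hereditary (imposed on every
-- restriction τ_[k]), such an insertion stays in the family iff s does and the slot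
-- (i, v) is admissible; admissibility is read off the ascent pattern of s and, when v
-- becomes the last letter, the sign of v (AndreSlot, SimsunSlot).
--
-- φᴮ removes the maximum m+2 from σ, maps the rest s recursively to t, and inserts
-- ±(m+1) into t at the same position, or at the end of t if it stood at the end of σ.
-- Inductively the ascent pattern of σ is that of φᴮ σ plus one final ascent, so André
-- slots of s correspond one-to-one to Simsun slots of t; soundness, injectivity,
-- surjectivity and the identity for Last then follow by induction on the size.
module Submission where

open import Defs
open import Data.Bool using (Bool; true; false; T)
open import Data.Bool.Properties using (T-≡)
open import Data.Integer as ℤ using (ℤ; +_; -[1+_]; ∣_∣; sign; _◃_; _-_; 1ℤ)
open import Data.Integer.Properties using (abs-◃; sign-◃; ◃-cong)
open import Data.List using (List; []; _∷_; [_]; _∷ʳ_; map; upTo; length)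
open import Data.List.Properties using (filter-reject; filter-all; upTo-∷ʳ; map-++; length-map; length-upTo)
open import Data.List.Relation.Unary.All as All using (All; []; _∷_)
open import Data.List.Relation.Unary.All.Properties using (all-upTo) renaming (map⁺ to All-map⁺; map⁻ to All-map⁻)
open import Data.List.Relation.Unary.Any as Any using (Any; here; there)
open import Data.List.Relation.Unary.Any.Properties using () renaming (map⁻ to Any-map⁻)
open import Data.List.Relation.Binary.Permutation.Propositional as Perm using (_↭_; ↭-sym; ↭-trans; module PermutationReasoning)
open import Data.List.Relation.Binary.Permutation.Propositional.Properties
  using (↭-length; ↭-singleton-inv; ↭-empty-inv; drop-∷; All-resp-↭; ∈-resp-↭; ∷↭∷ʳ)
open import Data.Nat using (ℕ; zero; suc; _≤_; _<_; _∸_; _⊓_; z≤n; s≤s; _≤?_; _≤ᵇ_; _≟_)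
open import Data.Nat.Properties
open import Data.Product using (Σ; ∃; _×_; _,_; proj₁; proj₂)
open import Data.Unit using (⊤; tt)
open import Function.Base using (case_of_)
open import Function.Bundles using (Equivalence)
open import Relation.Nullary using (¬_; yes; no; contradiction)
open import Relation.Binary.PropositionalEquality hiding ([_])

-- ins i v xs inserts v before the i-th letter of xs (at the end if i ≥ length xs).
ins : {A : Set} → ℕ → A → List A → List A
ins zero    v xs       = v ∷ xs
ins (suc i) v []       = v ∷ []
ins (suc i) v (x ∷ xs) = x ∷ ins i v xs

map-ins : {A B : Set} (f : A → B) (i : ℕ) (v : A) (xs : List A) →
  map f (ins i v xs) ≡ ins i (f v) (map f xs)
map-ins f zero    v xs       = refl
map-ins f (suc i) v []       = refl
map-ins f (suc i) v (x ∷ xs) = cong (f x ∷_) (map-ins f i v xs)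

length-ins : {A : Set} (i : ℕ) (v : A) (xs : List A) → length (ins i v xs) ≡ suc (length xs)
length-ins zero    v xs       = refl
length-ins (suc i) v []       = refl
length-ins (suc i) v (x ∷ xs) = cong suc (length-ins i v xs)

ins-↭ : {A : Set} (i : ℕ) (v : A) (xs : List A) → ins i v xs ↭ v ∷ xs
ins-↭ zero    v xs       = Perm.refl
ins-↭ (suc i) v []       = Perm.refl
ins-↭ (suc i) v (x ∷ xs) = ↭-trans (Perm.prep x (ins-↭ i v xs)) (Perm.swap x v Perm.refl)

All-ins⁻ : {A : Set} {P : A → Set} (i : ℕ) (v : A) (xs : List A) →
  All P (ins i v xs) → P v × All P xs
All-ins⁻ zero    v xs       (pv ∷ ps) = pv , ps
All-ins⁻ (suc i) v []       (pv ∷ _)  = pv , []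
All-ins⁻ (suc i) v (x ∷ xs) (px ∷ ps) with All-ins⁻ i v xs ps
... | pv , pxs = pv , px ∷ pxs

All-ins⁺ : {A : Set} {P : A → Set} (i : ℕ) (v : A) (xs : List A) →
  P v → All P xs → All P (ins i v xs)
All-ins⁺ zero    v xs       pv ps        = pv ∷ ps
All-ins⁺ (suc i) v []       pv ps        = pv ∷ []
All-ins⁺ (suc i) v (x ∷ xs) pv (px ∷ ps) = px ∷ All-ins⁺ i v xs pv ps

ins-end : {A : Set} (i : ℕ) (v : A) (xs : List A) → length xs ≤ i → ins i v xs ≡ xs ∷ʳ v
ins-end zero    v []       _         = refl
ins-end (suc i) v []       _         = refl
ins-end (suc i) v (x ∷ xs) (s≤s le) = cong (x ∷_) (ins-end i v xs le)

Last-∷ʳ : (xs : List ℤ) (v : ℤ) → Last (xs ∷ʳ v) ≡ v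
Last-∷ʳ []           v = refl
Last-∷ʳ (x ∷ [])     v = refl
Last-∷ʳ (x ∷ y ∷ xs) v = Last-∷ʳ (y ∷ xs) v

Last-ins-end : (i : ℕ) (v : ℤ) (xs : List ℤ) → length xs ≤ i → Last (ins i v xs) ≡ v
Last-ins-end i v xs len≤ = trans (cong Last (ins-end i v xs len≤)) (Last-∷ʳ xs v)

Last-ins-mid : (i : ℕ) (v : ℤ) (xs : List ℤ) → i < length xs → Last (ins i v xs) ≡ Last xs
Last-ins-mid zero          v (x ∷ xs)     _         = refl
Last-ins-mid (suc i)       v (x ∷ [])     (s≤s ())
Last-ins-mid (suc zero)    v (x ∷ y ∷ xs) _         = refl
Last-ins-mid (suc (suc i)) v (x ∷ y ∷ xs) (s≤s lt) = Last-ins-mid (suc i) v (y ∷ xs) lt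

Hereditary : (List ℕ → Set) → List ℕ → Set
Hereditary P τ = ∀ k → P (restrict k τ)

restrict-ins-large : ∀ {k v} (i : ℕ) (w : List ℕ) → ¬ v ≤ k →
  restrict k (ins i v w) ≡ restrict k w
restrict-ins-large {k} zero    w       v≰k = filter-reject (_≤? k) v≰k
restrict-ins-large {k} (suc i) []      v≰k = filter-reject (_≤? k) v≰k
restrict-ins-large {k} (suc i) (x ∷ w) v≰k with x ≤ᵇ k  -- the test filter performs on x
... | true  = cong (x ∷_) (restrict-ins-large i w v≰k)
... | false = restrict-ins-large i w v≰k

restrict-all : ∀ {k} (w : List ℕ) → All (_≤ k) w → restrict k w ≡ w
restrict-all {k} w = filter-all (_≤? k)

All-≤-weaken : ∀ {m k} (w : List ℕ) → m ≤ k → All (_≤ m) w → All (_≤ k) w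
All-≤-weaken w m≤k = All.map (λ x≤m → ≤-trans x≤m m≤k)

hereditary-whole : ∀ (P : List ℕ → Set) {m} (w : List ℕ) → All (_≤ m) w → Hereditary P w → P w
hereditary-whole P {m} w bound h = subst P (restrict-all w bound) (h m)

-- For a word w over [m], the restrictions of w with m+1 inserted are those of w
-- together with the whole new word; so heredity splits into these two parts.
hereditary-ins⁻ : ∀ (P : List ℕ → Set) {m} (i : ℕ) (w : List ℕ) → All (_≤ m) w →
  Hereditary P (ins i (suc m) w) → Hereditary P w × P (ins i (suc m) w)
hereditary-ins⁻ P {m} i w bound h = below , whole
  where
  whole : P (ins i (suc m) w)
  whole = hereditary-whole P (ins i (suc m) w)
            (All-ins⁺ i (suc m) w ≤-refl (All-≤-weaken w (n≤1+n m) bound)) h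
  below : Hereditary P w
  below k with suc m ≤? k
  ... | no  m≮k = subst P (restrict-ins-large i w m≮k) (h k)
  ... | yes m<k = subst P (begin
          restrict m (ins i (suc m) w) ≡⟨ restrict-ins-large i w 1+n≰n ⟩
          restrict m w                 ≡⟨ restrict-all w bound ⟩
          w                            ≡⟨ restrict-all w (All-≤-weaken w (≤-trans (n≤1+n m) m<k) bound) ⟨
          restrict k w                 ∎) (h m)
    where open ≡-Reasoning

hereditary-ins⁺ : ∀ (P : List ℕ → Set) {m} (i : ℕ) (w : List ℕ) → All (_≤ m) w →
  Hereditary P w → P (ins i (suc m) w) → Hereditary P (ins i (suc m) w)
hereditary-ins⁺ P {m} i w bound h p k with suc m ≤? k
... | no  m≮k = subst P (sym (restrict-ins-large i w m≮k)) (h k)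
... | yes m<k = subst P (sym (restrict-all (ins i (suc m) w)
                  (All-ins⁺ i (suc m) w m<k (All-≤-weaken w (≤-trans (n≤1+n m) m<k) bound)))) p

ascentAfter : ℕ → List ℕ → Bool
ascentAfter a []      = true
ascentAfter a (b ∷ _) = a ≤ᵇ b

-- The ascent pattern of a word records, for each letter, whether it is not followed
-- by a smaller one (the last letter counts as an ascent).  Inserting a maximal letter
-- before position i creates no double descent exactly when position i is an ascent.
ascents : List ℕ → List Bool
ascents []      = []
ascents (a ∷ w) = ascentAfter a w ∷ ascents w

length-ascents : (w : List ℕ) → length (ascents w) ≡ length w
length-ascents []      = refl
length-ascents (a ∷ w) = cong suc (length-ascents w)

-- AscentAt i p: position i of the pattern p is an ascent (vacuous beyond the end).
AscentAt : ℕ → List Bool → Set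
AscentAt _       []      = ⊤
AscentAt zero    (b ∷ _) = T b
AscentAt (suc i) (_ ∷ p) = AscentAt i p

AscentAt-beyond : (i : ℕ) (p : List Bool) → length p ≤ i → AscentAt i p
AscentAt-beyond i       []      _         = tt
AscentAt-beyond (suc i) (b ∷ p) (s≤s le) = AscentAt-beyond i p le

AscentAt-∷ʳ⁻ : (i : ℕ) (p : List Bool) → AscentAt i (p ∷ʳ true) → AscentAt i p
AscentAt-∷ʳ⁻ i       []      _   = tt
AscentAt-∷ʳ⁻ zero    (b ∷ p) asc = asc
AscentAt-∷ʳ⁻ (suc i) (b ∷ p) asc = AscentAt-∷ʳ⁻ i p asc

AscentAt-∷ʳ⁺ : (i : ℕ) (p : List Bool) → AscentAt i p → AscentAt i (p ∷ʳ true)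
AscentAt-∷ʳ⁺ zero    []      _   = tt
AscentAt-∷ʳ⁺ (suc i) []      _   = tt
AscentAt-∷ʳ⁺ zero    (b ∷ p) asc = asc
AscentAt-∷ʳ⁺ (suc i) (b ∷ p) asc = AscentAt-∷ʳ⁺ i p asc

-- The condition NoDoubleDescent imposes on the first letter x of x ∷ l.
NoDoubleDescentAt : ℕ → List ℕ → Set
NoDoubleDescentAt x (b ∷ c ∷ _) = ¬ (b < x × c < b)
NoDoubleDescentAt _ _           = ⊤

NoDoubleDescent-∷ : (x : ℕ) (l : List ℕ) →
  NoDoubleDescentAt x l → NoDoubleDescent l → NoDoubleDescent (x ∷ l)
NoDoubleDescent-∷ x []          _  _   = tt
NoDoubleDescent-∷ x (b ∷ [])    _  _   = tt
NoDoubleDescent-∷ x (b ∷ c ∷ l) hd ndd = hd , ndd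

NoDoubleDescent-tail : (x : ℕ) (l : List ℕ) → NoDoubleDescent (x ∷ l) → NoDoubleDescent l
NoDoubleDescent-tail x []          _   = tt
NoDoubleDescent-tail x (b ∷ [])    _   = tt
NoDoubleDescent-tail x (b ∷ c ∷ l) ndd = proj₂ ndd

ndd-ins⁻ : ∀ {M} (i : ℕ) (w : List ℕ) → All (_< M) w →
  NoDoubleDescent (ins i M w) → AscentAt i (ascents w)
ndd-ins⁻ zero    []          _           _         = tt
ndd-ins⁻ zero    (a ∷ [])    _           _         = tt
ndd-ins⁻ zero    (a ∷ b ∷ w) (a<M ∷ _)   (ndd , _) = ≤⇒≤ᵇ (≮⇒≥ (λ b<a → ndd (a<M , b<a)))
ndd-ins⁻ (suc i) []          _           _         = tt
ndd-ins⁻ {M} (suc i) (x ∷ w) (_ ∷ bound) ndd =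
  ndd-ins⁻ i w bound (NoDoubleDescent-tail x (ins i M w) ndd)

ndd-ins⁺ : ∀ {M} (i : ℕ) (w : List ℕ) → All (_< M) w →
  NoDoubleDescent w → AscentAt i (ascents w) → NoDoubleDescent (ins i M w)
ndd-ins⁺ zero    []          _ _   _   = tt
ndd-ins⁺ zero    (a ∷ [])    _ _   _   = tt
ndd-ins⁺ zero    (a ∷ b ∷ w) _ ndd asc = (λ (_ , b<a) → <⇒≱ b<a (≤ᵇ⇒≤ a b asc)) , ndd
ndd-ins⁺ (suc i) []          _ _   _   = tt
ndd-ins⁺ {M} (suc i) (x ∷ w) (x<M ∷ bound) ndd asc =
  NoDoubleDescent-∷ x (ins i M w) (head i w bound ndd)
    (ndd-ins⁺ i w bound (NoDoubleDescent-tail x w ndd) asc)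
  where
  -- x cannot start a double descent: either M follows x or the old neighbours do.
  head : (i : ℕ) (w : List ℕ) → All (_< M) w → NoDoubleDescent (x ∷ w) →
    NoDoubleDescentAt x (ins i M w)
  head zero          []          _         _   = tt
  head zero          (y ∷ w)     _         _   = λ (M<x , _) → <-asym x<M M<x
  head (suc i)       []          _         _   = tt
  head (suc zero)    (y ∷ w)     (y<M ∷ _) _   = λ (_ , M<y) → <-asym y<M M<y
  head (suc (suc i)) (y ∷ [])    (y<M ∷ _) _   = λ (_ , M<y) → <-asym y<M M<y
  head (suc (suc i)) (y ∷ z ∷ w) _         ndd = proj₁ ndd

EndsWithAscent-∷ : (x : ℕ) (l : List ℕ) → 2 ≤ length l → EndsWithAscent l → EndsWithAscent (x ∷ l)
EndsWithAscent-∷ x (a ∷ [])    (s≤s ())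
EndsWithAscent-∷ x (a ∷ b ∷ _) _ ewa = ewa

EndsWithAscent-tail : (x : ℕ) (l : List ℕ) → 2 ≤ length l → EndsWithAscent (x ∷ l) → EndsWithAscent l
EndsWithAscent-tail x (a ∷ [])    (s≤s ())
EndsWithAscent-tail x (a ∷ b ∷ _) _ ewa = ewa

two≤length-ins : ∀ {A : Set} (i : ℕ) (v : A) (x : A) (xs : List A) → 2 ≤ length (ins i v (x ∷ xs))
two≤length-ins i v x xs = subst (2 ≤_) (sym (length-ins i v (x ∷ xs))) (s≤s (s≤s z≤n))

ewa-∷ʳ : ∀ {M} (w : List ℕ) → All (_< M) w → EndsWithAscent (w ∷ʳ M)
ewa-∷ʳ []              _                 = tt
ewa-∷ʳ (x ∷ [])        (x<M ∷ _)         = x<M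
ewa-∷ʳ (x ∷ y ∷ [])    (_ ∷ y<M ∷ _)     = y<M
ewa-∷ʳ (x ∷ y ∷ z ∷ w) (_ ∷ bound)       = ewa-∷ʳ (y ∷ z ∷ w) bound

ewa-ins-early : ∀ {M} (i : ℕ) (w : List ℕ) → suc i < length w →
  EndsWithAscent w → EndsWithAscent (ins i M w)
ewa-ins-early zero    (x ∷ [])        (s≤s ())
ewa-ins-early zero    (x ∷ y ∷ w)     _         ewa = ewa
ewa-ins-early (suc i) (x ∷ y ∷ [])    (s≤s (s≤s ()))
ewa-ins-early {M} (suc i) (x ∷ y ∷ z ∷ w) (s≤s lt) ewa =
  EndsWithAscent-∷ x (ins i M (y ∷ z ∷ w)) (two≤length-ins i M y (z ∷ w)) (ewa-ins-early i (y ∷ z ∷ w) lt ewa)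

¬ewa-ins-penultimate : ∀ {M} (i : ℕ) (w : List ℕ) → All (_< M) w → suc i ≡ length w →
  ¬ EndsWithAscent (ins i M w)
¬ewa-ins-penultimate zero    (a ∷ [])    (a<M ∷ _)   _  M<a = <-asym a<M M<a
¬ewa-ins-penultimate {M} (suc i) (x ∷ y ∷ w) (_ ∷ bound) eq ewa =
  ¬ewa-ins-penultimate i (y ∷ w) bound (suc-injective eq)
    (EndsWithAscent-tail x (ins i M (y ∷ w)) (two≤length-ins i M y w) ewa)

≤ᵇ-true : ∀ {m n} → m ≤ n → (m ≤ᵇ n) ≡ true
≤ᵇ-true m≤n = Equivalence.to T-≡ (≤⇒≤ᵇ m≤n)

≤ᵇ-false : ∀ {m n} → n < m → (m ≤ᵇ n) ≡ false
≤ᵇ-false {m} {n} n<m with m ≤ᵇ n | ≤ᵇ⇒≤ m n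
... | false | _   = refl
... | true  | m≤n = contradiction (m≤n tt) (<⇒≱ n<m)

-- The ascent pattern after inserting a maximal letter before position i,
-- computed from the pattern before the insertion.
insAscent : ℕ → List Bool → List Bool
insAscent zero          []      = true ∷ []
insAscent zero          (b ∷ p) = false ∷ b ∷ p
insAscent (suc i)       []      = true ∷ []
insAscent (suc zero)    (b ∷ p) = true ∷ insAscent zero p
insAscent (suc (suc i)) (b ∷ p) = b ∷ insAscent (suc i) p

ascentAfter-ins : ∀ {x M} (i : ℕ) (w : List ℕ) → x < M → ascentAfter x (ins (suc i) M w) ≡ ascentAfter x w
ascentAfter-ins i []      x<M = ≤ᵇ-true (<⇒≤ x<M)
ascentAfter-ins i (y ∷ w) _   = refl

ascentAfter-∷ʳ : ∀ {x M} (w : List ℕ) → x < M → ascentAfter x (w ∷ʳ M) ≡ ascentAfter x w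
ascentAfter-∷ʳ []      x<M = ≤ᵇ-true (<⇒≤ x<M)
ascentAfter-∷ʳ (y ∷ w) _   = refl

ascents-ins : ∀ {M} (i : ℕ) (w : List ℕ) → All (_< M) w → ascents (ins i M w) ≡ insAscent i (ascents w)
ascents-ins zero          []      _             = refl
ascents-ins zero          (x ∷ w) (x<M ∷ _)     = cong (_∷ ascents (x ∷ w)) (≤ᵇ-false x<M)
ascents-ins (suc i)       []      _             = refl
ascents-ins (suc zero)    (x ∷ w) (x<M ∷ bound) =
  cong₂ _∷_ (≤ᵇ-true (<⇒≤ x<M)) (ascents-ins zero w bound)
ascents-ins (suc (suc i)) (x ∷ w) (x<M ∷ bound) =
  cong₂ _∷_ (ascentAfter-ins i w x<M) (ascents-ins (suc i) w bound)

ascents-∷ʳ : ∀ {M} (w : List ℕ) → All (_< M) w → ascents (w ∷ʳ M) ≡ ascents w ∷ʳ true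
ascents-∷ʳ []      _             = refl
ascents-∷ʳ (x ∷ w) (x<M ∷ bound) = cong₂ _∷_ (ascentAfter-∷ʳ w x<M) (ascents-∷ʳ w bound)

ascents-ins-end : ∀ {M} (i : ℕ) (w : List ℕ) → All (_< M) w → length w ≤ i →
  ascents (ins i M w) ≡ ascents w ∷ʳ true
ascents-ins-end {M} i w bound le = trans (cong ascents (ins-end i M w le)) (ascents-∷ʳ w bound)

insAscent-∷ʳ : (i : ℕ) (p : List Bool) → i < length p →
  insAscent i (p ∷ʳ true) ≡ insAscent i p ∷ʳ true
insAscent-∷ʳ zero          (b ∷ p)     _        = refl
insAscent-∷ʳ (suc zero)    (b ∷ [])    (s≤s ())
insAscent-∷ʳ (suc zero)    (b ∷ c ∷ p) _        = refl
insAscent-∷ʳ (suc (suc i)) (b ∷ p)     (s≤s lt) = cong (b ∷_) (insAscent-∷ʳ (suc i) p lt)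

-- A letter v whose absolute value exceeds those of all other letters is a suffix
-- minimum only when nothing follows it, so inserting it before position i keeps the
-- sign condition iff v is positive in case i is the end.
sign-ins⁻ : (i : ℕ) (v : ℤ) (s : List ℤ) → All (λ y → ∣ y ∣ < ∣ v ∣) s →
  SignCondition (ins i v s) → SignCondition s × (i ≡ length s → ℤ.0ℤ ℤ.< v)
sign-ins⁻ zero    v []      _              (pos , _)      = tt , λ _ → pos []
sign-ins⁻ zero    v (y ∷ s) _              (_ , sc)       = sc , λ ()
sign-ins⁻ (suc i) v []      _              (pos , _)      = tt , λ ()
sign-ins⁻ (suc i) v (x ∷ s) (x<v ∷ bound) (minPos , sc) with sign-ins⁻ i v s bound sc
... | scs , endPos =
  ((λ xMin → minPos (All-ins⁺ i v s (<⇒≤ x<v) xMin)) , scs) , λ e → endPos (suc-injective e)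

sign-ins⁺ : (i : ℕ) (v : ℤ) (s : List ℤ) → All (λ y → ∣ y ∣ < ∣ v ∣) s → i ≤ length s →
  SignCondition s → (i ≡ length s → ℤ.0ℤ ℤ.< v) → SignCondition (ins i v s)
sign-ins⁺ zero    v []      _             _         _             endPos = (λ _ → endPos refl) , tt
sign-ins⁺ zero    v (y ∷ s) (y<v ∷ _)     _         sc            _      =
  (λ { (v≤y ∷ _) → contradiction v≤y (<⇒≱ y<v) }) , sc
sign-ins⁺ (suc i) v (x ∷ s) (_ ∷ bound)   (s≤s i≤) (minPos , sc) endPos =
  (λ xMin → minPos (proj₂ (All-ins⁻ i v s xMin))) , sign-ins⁺ i v s bound i≤ sc (λ e → endPos (cong suc e))

unsigned : List ℤ → List ℕ
unsigned = map ∣_∣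

oneTo-∷ : (m : ℕ) → oneTo (suc m) ↭ suc m ∷ oneTo m
oneTo-∷ m = subst (_↭ suc m ∷ oneTo m) (sym oneTo-∷ʳ) (↭-sym (∷↭∷ʳ (suc m) (oneTo m)))
  where
  oneTo-∷ʳ : oneTo (suc m) ≡ oneTo m ∷ʳ suc m
  oneTo-∷ʳ = trans (cong (map suc) (sym (upTo-∷ʳ m))) (map-++ suc (upTo m) [ m ])

letters-bounded : ∀ {m} (s : List ℤ) → IsSignedPerm m s → All (_≤ m) (unsigned s)
letters-bounded {m} s perm = All-resp-↭ (↭-sym perm) (All-map⁺ (all-upTo m))

length-signedPerm : ∀ {m} (s : List ℤ) → IsSignedPerm m s → length s ≡ m
length-signedPerm {m} s perm = begin
  length s                    ≡⟨ length-map ∣_∣ s ⟨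
  length (unsigned s)         ≡⟨ ↭-length perm ⟩
  length (map suc (upTo m))   ≡⟨ length-map suc (upTo m) ⟩
  length (upTo m)             ≡⟨ length-upTo m ⟩
  m                           ∎
  where open ≡-Reasoning

unsigned-ins : ∀ {M} (i : ℕ) (v : ℤ) (s : List ℤ) → ∣ v ∣ ≡ M → unsigned (ins i v s) ≡ ins i M (unsigned s)
unsigned-ins i v s refl = map-ins ∣_∣ i v s

signedPerm-ins⁺ : ∀ {m} (i : ℕ) (v : ℤ) (s : List ℤ) → ∣ v ∣ ≡ suc m →
  IsSignedPerm m s → IsSignedPerm (suc m) (ins i v s)
signedPerm-ins⁺ {m} i v s ∣v∣ perm = subst (_↭ oneTo (suc m)) (sym (unsigned-ins i v s ∣v∣))
  (↭-trans (ins-↭ i (suc m) (unsigned s)) (↭-trans (Perm.prep (suc m) perm) (↭-sym (oneTo-∷ m))))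

signedPerm-ins⁻ : ∀ {m} (i : ℕ) (v : ℤ) (s : List ℤ) → ∣ v ∣ ≡ suc m →
  IsSignedPerm (suc m) (ins i v s) → IsSignedPerm m s
signedPerm-ins⁻ {m} i v s ∣v∣ perm = drop-∷ (begin
  suc m ∷ unsigned s         ↭⟨ ins-↭ i (suc m) (unsigned s) ⟨
  ins i (suc m) (unsigned s) ≡⟨ unsigned-ins i v s ∣v∣ ⟨
  unsigned (ins i v s)       ↭⟨ perm ⟩
  oneTo (suc m)              ↭⟨ oneTo-∷ m ⟩
  suc m ∷ oneTo m            ∎)
  where open PermutationReasoning

letters-below : ∀ {m} (v : ℤ) (s : List ℤ) → IsSignedPerm m s → ∣ v ∣ ≡ suc m → All (λ y → ∣ y ∣ < ∣ v ∣) s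
letters-below v s perm ∣v∣ = All-map⁻ (All.map (λ y≤m → subst (_ <_) (sym ∣v∣) (s≤s y≤m)) (letters-bounded s perm))

Any-ins : {A : Set} {P : A → Set} (xs : List A) → Any P xs →
  Σ ℕ λ i → Σ A λ v → Σ (List A) λ s → xs ≡ ins i v s × P v × i ≤ length s
Any-ins (x ∷ xs) (here px)  = 0 , x , xs , refl , px , z≤n
Any-ins (x ∷ xs) (there pxs) with Any-ins xs pxs
... | i , v , s , refl , pv , i≤ = suc i , v , x ∷ s , refl , pv , s≤s i≤

decompose : ∀ {m} (σ : List ℤ) → IsSignedPerm (suc m) σ →
  Σ ℕ λ i → Σ ℤ λ v → Σ (List ℤ) λ s → σ ≡ ins i v s × ∣ v ∣ ≡ suc m × i ≤ length s
decompose {m} σ perm =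
  Any-ins σ (Any.map sym (Any-map⁻ (∈-resp-↭ (↭-sym (↭-trans perm (oneTo-∷ m))) (here refl))))

AndreCondition : List ℕ → Set
AndreCondition l = NoDoubleDescent l × EndsWithAscent l

data AndrePosition (m i : ℕ) (w : List ℕ) : Set where
  atEnd        : i ≡ suc m → AndrePosition m i w
  beforeAscent : i < m → AscentAt i (ascents w) → AndrePosition m i w

AndrePosition-≤ : ∀ {m i} {w : List ℕ} → AndrePosition m i w → i ≤ suc m
AndrePosition-≤ (atEnd i≡)          = ≤-reflexive i≡
AndrePosition-≤ (beforeAscent i<m _) = ≤-trans (<⇒≤ i<m) (n≤1+n _)

-- The position just before the last letter is excluded
-- by EndsWithAscent, every other one by NoDoubleDescent unless it precedes an ascent.
andreWord-ins⁻ : ∀ {m} (i : ℕ) (w : List ℕ) → All (_≤ suc m) w → length w ≡ suc m → i ≤ suc m →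
  IsAndre (ins i (suc (suc m)) w) → IsAndre w × AndrePosition m i w
andreWord-ins⁻ {m} i w bound len i≤ andre =
  let (andreW , (ndd , ewa)) = hereditary-ins⁻ AndreCondition i w bound andre
      position : AndrePosition m i w
      position = case i ≟ suc m of λ where
        (yes i≡) → atEnd i≡
        (no i≢)  → beforeAscent
                     (≤∧≢⇒< (≤-pred (≤∧≢⇒< i≤ i≢))
                        (λ i≡m → ¬ewa-ins-penultimate i w (All.map s≤s bound)
                                   (trans (cong suc i≡m) (sym len)) ewa))
                     (ndd-ins⁻ i w (All.map s≤s bound) ndd)
  in andreW , position

andreWord-ins⁺ : ∀ {m} (i : ℕ) (w : List ℕ) → All (_≤ suc m) w → length w ≡ suc m →
  IsAndre w → AndrePosition m i w → IsAndre (ins i (suc (suc m)) w)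
andreWord-ins⁺ {m} i w bound len andre position =
  hereditary-ins⁺ AndreCondition i w bound andre (ndd-ins⁺ i w below ndd (ascent position) , endsWithAscent position)
  where
  below : All (_< suc (suc m)) w
  below = All.map s≤s bound
  ndd : NoDoubleDescent w
  ndd = proj₁ (hereditary-whole AndreCondition w bound andre)
  ewa : EndsWithAscent w
  ewa = proj₂ (hereditary-whole AndreCondition w bound andre)
  ascent : AndrePosition m i w → AscentAt i (ascents w)
  ascent (atEnd i≡)           =
    AscentAt-beyond i (ascents w) (≤-reflexive (trans (length-ascents w) (trans len (sym i≡))))
  ascent (beforeAscent _ asc) = asc
  endsWithAscent : AndrePosition m i w → EndsWithAscent (ins i (suc (suc m)) w)
  endsWithAscent (atEnd i≡)           =
    subst EndsWithAscent (sym (ins-end i _ w (≤-reflexive (trans len (sym i≡))))) (ewa-∷ʳ w below)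
  endsWithAscent (beforeAscent i<m _) = ewa-ins-early i w (subst (suc i <_) (sym len) (s≤s i<m)) ewa

AndreSlot : ℕ → ℕ → ℤ → List ℤ → Set
AndreSlot m i v s = AndrePosition m i (unsigned s) × (i ≡ suc m → ℤ.0ℤ ℤ.< v)

andre-ins⁻ : ∀ {m} (i : ℕ) (v : ℤ) (s : List ℤ) → ∣ v ∣ ≡ suc (suc m) → i ≤ length s →
  SignedAndre (suc (suc m)) (ins i v s) → SignedAndre (suc m) s × AndreSlot m i v s
andre-ins⁻ {m} i v s ∣v∣ i≤ (perm , andre , sc) =
  let permS           = signedPerm-ins⁻ i v s ∣v∣ perm
      lenS            = length-signedPerm s permS
      (andreS , pos)  = andreWord-ins⁻ i (unsigned s) (letters-bounded s permS)
                          (trans (length-map ∣_∣ s) lenS) (subst (i ≤_) lenS i≤)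
                          (subst IsAndre (unsigned-ins i v s ∣v∣) andre)
      (scS , endPos)  = sign-ins⁻ i v s (letters-below v s permS ∣v∣) sc
  in (permS , andreS , scS) , pos , λ i≡ → endPos (trans i≡ (sym lenS))

andre-ins⁺ : ∀ {m} (i : ℕ) (v : ℤ) (s : List ℤ) → ∣ v ∣ ≡ suc (suc m) →
  SignedAndre (suc m) s → AndreSlot m i v s → SignedAndre (suc (suc m)) (ins i v s)
andre-ins⁺ {m} i v s ∣v∣ (perm , andre , sc) (pos , endPos) =
  signedPerm-ins⁺ i v s ∣v∣ perm ,
  subst IsAndre (sym (unsigned-ins i v s ∣v∣))
    (andreWord-ins⁺ i (unsigned s) (letters-bounded s perm) (trans (length-map ∣_∣ s) lenS) andre pos) ,
  sign-ins⁺ i v s (letters-below v s perm ∣v∣) (subst (i ≤_) (sym lenS) (AndrePosition-≤ pos)) sc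
    (λ i≡ → endPos (trans i≡ lenS))
  where
  lenS : length s ≡ suc m
  lenS = length-signedPerm s perm

simsunWord-ins⁻ : ∀ {m} (j : ℕ) (w : List ℕ) → All (_≤ m) w →
  IsSimsun (ins j (suc m) w) → IsSimsun w × AscentAt j (ascents w)
simsunWord-ins⁻ j w bound simsun =
  let (simsunW , ndd) = hereditary-ins⁻ NoDoubleDescent j w bound simsun
  in simsunW , ndd-ins⁻ j w (All.map s≤s bound) ndd

simsunWord-ins⁺ : ∀ {m} (j : ℕ) (w : List ℕ) → All (_≤ m) w →
  IsSimsun w → AscentAt j (ascents w) → IsSimsun (ins j (suc m) w)
simsunWord-ins⁺ j w bound simsun asc =
  hereditary-ins⁺ NoDoubleDescent j w bound simsun
    (ndd-ins⁺ j w (All.map s≤s bound) (hereditary-whole NoDoubleDescent w bound simsun) asc)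

SimsunSlot : ℕ → ℕ → ℤ → List ℤ → Set
SimsunSlot m j u t = AscentAt j (ascents (unsigned t)) × (j ≡ m → ℤ.0ℤ ℤ.< u)

simsun-ins⁻ : ∀ {m} (j : ℕ) (u : ℤ) (t : List ℤ) → ∣ u ∣ ≡ suc m → j ≤ length t →
  SignedSimsun (suc m) (ins j u t) → SignedSimsun m t × SimsunSlot m j u t
simsun-ins⁻ {m} j u t ∣u∣ j≤ (perm , simsun , sc) =
  let permT           = signedPerm-ins⁻ j u t ∣u∣ perm
      (simsunT , asc) = simsunWord-ins⁻ j (unsigned t) (letters-bounded t permT)
                          (subst IsSimsun (unsigned-ins j u t ∣u∣) simsun)
      (scT , endPos)  = sign-ins⁻ j u t (letters-below u t permT ∣u∣) sc
  in (permT , simsunT , scT) , asc , λ j≡ → endPos (trans j≡ (sym (length-signedPerm t permT)))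

simsun-ins⁺ : ∀ {m} (j : ℕ) (u : ℤ) (t : List ℤ) → ∣ u ∣ ≡ suc m → j ≤ m →
  SignedSimsun m t → SimsunSlot m j u t → SignedSimsun (suc m) (ins j u t)
simsun-ins⁺ {m} j u t ∣u∣ j≤ (perm , simsun , sc) (asc , endPos) =
  signedPerm-ins⁺ j u t ∣u∣ perm ,
  subst IsSimsun (sym (unsigned-ins j u t ∣u∣))
    (simsunWord-ins⁺ j (unsigned t) (letters-bounded t perm) simsun asc) ,
  sign-ins⁺ j u t (letters-below u t perm ∣u∣) (subst (j ≤_) (sym lenT) j≤) sc
    (λ j≡ → endPos (trans j≡ lenT))
  where
  lenT : length t ≡ m
  lenT = length-signedPerm t perm

resign : ℕ → ℤ → ℤ
resign n v = sign v ◃ n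

∣resign∣ : (n : ℕ) (v : ℤ) → ∣ resign n v ∣ ≡ n
∣resign∣ n v = abs-◃ (sign v) n

sign-resign : (n : ℕ) (v : ℤ) → sign (resign (suc n) v) ≡ sign v
sign-resign n v = sign-◃ (sign v) (suc n)

resign-injective : ∀ {n} (v v′ : ℤ) → ∣ v ∣ ≡ ∣ v′ ∣ → resign (suc n) v ≡ resign (suc n) v′ → v ≡ v′
resign-injective {n} v v′ ∣v∣≡ eq =
  ◃-cong (trans (sym (sign-resign n v)) (trans (cong sign eq) (sign-resign n v′))) ∣v∣≡

resign-resign : ∀ {m} (u : ℤ) → ∣ u ∣ ≡ suc m → resign (suc m) (resign (suc (suc m)) u) ≡ u
resign-resign {m} u ∣u∣ =
  ◃-cong (trans (sign-resign m (resign (suc (suc m)) u)) (sign-resign (suc m) u))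
         (trans (∣resign∣ (suc m) (resign (suc (suc m)) u)) (sym ∣u∣))

resign-positive : ∀ {n} {v : ℤ} → ℤ.0ℤ ℤ.< v → ℤ.0ℤ ℤ.< resign (suc n) v
resign-positive (ℤ.+<+ _) = ℤ.+<+ (s≤s z≤n)

resign-pred : ∀ {m} (v : ℤ) → ∣ v ∣ ≡ suc (suc m) → ℤ.0ℤ ℤ.< v → v - 1ℤ ≡ resign (suc m) v
resign-pred (+ _) refl _ = refl

behind : ℤ → ℕ × ℤ × List ℤ → ℕ × ℤ × List ℤ
behind x (i , v , s) = suc i , v , x ∷ s

extract : ℕ → List ℤ → ℕ × ℤ × List ℤ
extract M []       = 0 , ℤ.0ℤ , []
extract M (x ∷ xs) with ∣ x ∣ ≟ M
... | yes _ = 0 , x , xs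
... | no  _ = behind x (extract M xs)

extract-ins : ∀ {M} (i : ℕ) (v : ℤ) (s : List ℤ) → All (λ y → ∣ y ∣ ≢ M) s → ∣ v ∣ ≡ M →
  i ≤ length s → extract M (ins i v s) ≡ (i , v , s)
extract-ins {M} zero v s _ ∣v∣ _ with ∣ v ∣ ≟ M
... | yes _     = refl
... | no  ∣v∣≢ = contradiction ∣v∣ ∣v∣≢
extract-ins {M} (suc i) v (x ∷ s) (∣x∣≢ ∷ others) ∣v∣ (s≤s i≤) with ∣ x ∣ ≟ M
... | yes ∣x∣≡ = contradiction ∣x∣≡ ∣x∣≢
... | no  _    = cong (behind x) (extract-ins i v s others ∣v∣ i≤)

letters-not-max : ∀ {m} (s : List ℤ) → IsSignedPerm m s → All (λ y → ∣ y ∣ ≢ suc m) s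
letters-not-max {m} s perm =
  All-map⁻ (All.map (λ y≤m y≡ → 1+n≰n (subst (_≤ m) y≡ y≤m)) (letters-bounded s perm))

-- One step of φᴮ on the extracted maximum (i , v , s) of a permutation of [m+2]: map
-- s by f and insert ±(m+1), with the sign of v, at position i, or at the end (position
-- m) if v was last (i = m+1).
reinsert : ℕ → (List ℤ → List ℤ) → ℕ × ℤ × List ℤ → List ℤ
reinsert m f (i , v , s) = ins (i ⊓ m) (resign (suc m) v) (f s)

φᴮ : ℕ → List ℤ → List ℤ
φᴮ zero          _ = []
φᴮ (suc zero)    _ = []
φᴮ (suc (suc m)) σ = reinsert m (φᴮ (suc m)) (extract (suc (suc m)) σ)

φᴮ-ins : ∀ {m} (i : ℕ) (v : ℤ) (s : List ℤ) → IsSignedPerm (suc m) s → ∣ v ∣ ≡ suc (suc m) →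
  i ≤ length s → φᴮ (suc (suc m)) (ins i v s) ≡ ins (i ⊓ m) (resign (suc m) v) (φᴮ (suc m) s)
φᴮ-ins {m} i v s perm ∣v∣ i≤ =
  cong (reinsert m (φᴮ (suc m))) (extract-ins i v s (letters-not-max s perm) ∣v∣ i≤)

⊓-atEnd : ∀ {m i} → i ≡ suc m → i ⊓ m ≡ m
⊓-atEnd {m} refl = m≥n⇒m⊓n≡n (n≤1+n m)

⊓-before : ∀ {m i} → i < m → i ⊓ m ≡ i
⊓-before i<m = m≤n⇒m⊓n≡m (<⇒≤ i<m)

-- The invariant of the recursion: the ascent pattern of an André permutation is that
-- of its image followed by one more ascent.
OneAscentLonger : List ℕ → List ℕ → Set
OneAscentLonger ws wt = ascents ws ≡ ascents wt ∷ʳ true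

oneAscentLonger-ins : ∀ {m i} (ws wt : List ℕ) → All (_≤ suc m) ws → All (_≤ m) wt →
  length ws ≡ suc m → length wt ≡ m → OneAscentLonger ws wt → AndrePosition m i ws →
  OneAscentLonger (ins i (suc (suc m)) ws) (ins (i ⊓ m) (suc m) wt)
oneAscentLonger-ins {m} {i} ws wt boundS boundT lenS lenT shift (atEnd i≡) = begin
  ascents (ins i (suc (suc m)) ws)
    ≡⟨ ascents-ins-end i ws (All.map s≤s boundS) (≤-reflexive (trans lenS (sym i≡))) ⟩
  ascents ws ∷ʳ true
    ≡⟨ cong (_∷ʳ true) shift ⟩
  (ascents wt ∷ʳ true) ∷ʳ true
    ≡⟨ cong (_∷ʳ true) (ascents-ins-end (i ⊓ m) wt (All.map s≤s boundT)
                          (≤-reflexive (trans lenT (sym (⊓-atEnd i≡))))) ⟨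
  ascents (ins (i ⊓ m) (suc m) wt) ∷ʳ true
    ∎
  where open ≡-Reasoning
oneAscentLonger-ins {m} {i} ws wt boundS boundT lenS lenT shift (beforeAscent i<m _) = begin
  ascents (ins i (suc (suc m)) ws)
    ≡⟨ ascents-ins i ws (All.map s≤s boundS) ⟩
  insAscent i (ascents ws)
    ≡⟨ cong (insAscent i) shift ⟩
  insAscent i (ascents wt ∷ʳ true)
    ≡⟨ insAscent-∷ʳ i (ascents wt) (subst (i <_) (sym (trans (length-ascents wt) lenT)) i<m) ⟩
  insAscent i (ascents wt) ∷ʳ true
    ≡⟨ cong (_∷ʳ true) (ascents-ins i wt (All.map s≤s boundT)) ⟨
  ascents (ins i (suc m) wt) ∷ʳ true
    ≡⟨ cong (λ j → ascents (ins j (suc m) wt) ∷ʳ true) (⊓-before i<m) ⟨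
  ascents (ins (i ⊓ m) (suc m) wt) ∷ʳ true
    ∎
  where open ≡-Reasoning

andreSlot→simsunSlot : ∀ {m i} (v : ℤ) (s t : List ℤ) → length t ≡ m →
  OneAscentLonger (unsigned s) (unsigned t) → AndreSlot m i v s →
  SimsunSlot m (i ⊓ m) (resign (suc m) v) t
andreSlot→simsunSlot {m} {i} v s t lenT shift (atEnd i≡ , endPos) =
  AscentAt-beyond (i ⊓ m) (ascents (unsigned t))
    (≤-reflexive (trans (length-ascents (unsigned t))
                   (trans (length-map ∣_∣ t) (trans lenT (sym (⊓-atEnd i≡)))))) ,
  λ _ → resign-positive (endPos i≡)
andreSlot→simsunSlot {m} {i} v s t lenT shift (beforeAscent i<m asc , _) =
  subst (λ j → AscentAt j (ascents (unsigned t))) (sym (⊓-before i<m))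
    (AscentAt-∷ʳ⁻ i (ascents (unsigned t)) (subst (AscentAt i) shift asc)) ,
  λ i⊓m≡m → contradiction (trans (sym (⊓-before i<m)) i⊓m≡m) (<⇒≢ i<m)

simsunSlot→andreSlot : ∀ {m j} (u : ℤ) (s t : List ℤ) → j ≤ m →
  OneAscentLonger (unsigned s) (unsigned t) → SimsunSlot m j u t →
  Σ ℕ λ i → AndreSlot m i (resign (suc (suc m)) u) s × i ⊓ m ≡ j
simsunSlot→andreSlot {m} {j} u s t j≤m shift (asc , endPos) with j ≟ m
... | yes j≡m =
  suc m , (atEnd refl , λ _ → resign-positive (endPos j≡m)) , trans (⊓-atEnd refl) (sym j≡m)
... | no  j≢m =
  j , (beforeAscent j<m ascS , λ j≡ → contradiction (subst (_≤ m) j≡ j≤m) 1+n≰n) , ⊓-before j<m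
  where
  j<m : j < m
  j<m = ≤∧≢⇒< j≤m j≢m
  ascS : AscentAt j (ascents (unsigned s))
  ascS = subst (AscentAt j) (sym shift) (AscentAt-∷ʳ⁺ j (ascents (unsigned t)) asc)

andrePosition-injective : ∀ {m i i′} {w w′ : List ℕ} → AndrePosition m i w → AndrePosition m i′ w′ →
  i ⊓ m ≡ i′ ⊓ m → i ≡ i′
andrePosition-injective (atEnd i≡) (atEnd i′≡) _ = trans i≡ (sym i′≡)
andrePosition-injective (atEnd i≡) (beforeAscent i′<m _) eq =
  contradiction (trans (sym (⊓-before i′<m)) (trans (sym eq) (⊓-atEnd i≡))) (<⇒≢ i′<m)
andrePosition-injective (beforeAscent i<m _) (atEnd i′≡) eq =
  contradiction (trans (sym (⊓-before i<m)) (trans eq (⊓-atEnd i′≡))) (<⇒≢ i<m)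
andrePosition-injective (beforeAscent i<m _) (beforeAscent i′<m _) eq =
  trans (sym (⊓-before i<m)) (trans eq (⊓-before i′<m))

last-ins : ∀ {m i} (v : ℤ) (s t : List ℤ) → length s ≡ suc m → length t ≡ m → ∣ v ∣ ≡ suc (suc m) →
  AndreSlot m i v s → Last s - 1ℤ ≡ Last t →
  Last (ins i v s) - 1ℤ ≡ Last (ins (i ⊓ m) (resign (suc m) v) t)
last-ins {m} {i} v s t lenS lenT ∣v∣ (atEnd i≡ , endPos) _ = begin
  Last (ins i v s) - 1ℤ
    ≡⟨ cong (_- 1ℤ) (Last-ins-end i v s (≤-reflexive (trans lenS (sym i≡)))) ⟩
  v - 1ℤ
    ≡⟨ resign-pred v ∣v∣ (endPos i≡) ⟩
  resign (suc m) v
    ≡⟨ Last-ins-end (i ⊓ m) _ t (≤-reflexive (trans lenT (sym (⊓-atEnd i≡)))) ⟨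
  Last (ins (i ⊓ m) (resign (suc m) v) t)
    ∎
  where open ≡-Reasoning
last-ins {m} {i} v s t lenS lenT ∣v∣ (beforeAscent i<m _ , _) lastST = begin
  Last (ins i v s) - 1ℤ
    ≡⟨ cong (_- 1ℤ) (Last-ins-mid i v s (subst (i <_) (sym lenS) (≤-trans i<m (n≤1+n m)))) ⟩
  Last s - 1ℤ
    ≡⟨ lastST ⟩
  Last t
    ≡⟨ Last-ins-mid (i ⊓ m) _ t (subst₂ _<_ (sym (⊓-before i<m)) (sym lenT) i<m) ⟨
  Last (ins (i ⊓ m) (resign (suc m) v) t)
    ∎
  where open ≡-Reasoning

oneAscentLonger-step : ∀ {m i} (v : ℤ) (s t : List ℤ) → IsSignedPerm (suc m) s → IsSignedPerm m t →
  ∣ v ∣ ≡ suc (suc m) → OneAscentLonger (unsigned s) (unsigned t) → AndrePosition m i (unsigned s) →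
  OneAscentLonger (unsigned (ins i v s)) (unsigned (ins (i ⊓ m) (resign (suc m) v) t))
oneAscentLonger-step {m} {i} v s t permS permT ∣v∣ shift pos =
  subst₂ OneAscentLonger (sym (unsigned-ins i v s ∣v∣)) (sym (unsigned-ins (i ⊓ m) _ t (∣resign∣ (suc m) v)))
    (oneAscentLonger-ins (unsigned s) (unsigned t) (letters-bounded s permS) (letters-bounded t permT)
      (trans (length-map ∣_∣ s) (length-signedPerm s permS))
      (trans (length-map ∣_∣ t) (length-signedPerm t permT))
      shift pos)

andre-one : (σ : List ℤ) → SignedAndre 1 σ → σ ≡ + 1 ∷ []
andre-one σ         (perm , _ , _)       with ↭-singleton-inv perm
andre-one (+ .1 ∷ [])     _                   | refl = refl
andre-one (-[1+ 0 ] ∷ []) (_ , _ , (pos , _)) | refl with pos []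
... | ()

andre-one-valid : SignedAndre 1 (+ 1 ∷ [])
andre-one-valid = Perm.refl , restrictions , (λ _ → ℤ.+<+ (s≤s z≤n)) , tt
  where
  restrictions : IsAndre (1 ∷ [])
  restrictions zero    = tt , tt
  restrictions (suc k) = tt , tt

simsun-zero : (τ : List ℤ) → SignedSimsun 0 τ → τ ≡ []
simsun-zero []      _ = refl
simsun-zero (x ∷ τ) (perm , _) with ↭-empty-inv perm
... | ()

φᴮ-sound : (m : ℕ) (σ : List ℤ) → SignedAndre (suc m) σ →
  SignedSimsun m (φᴮ (suc m) σ) × OneAscentLonger (unsigned σ) (unsigned (φᴮ (suc m) σ))
φᴮ-sound zero σ andre rewrite andre-one σ andre = (Perm.refl , (λ _ → tt) , tt) , refl
φᴮ-sound (suc m) σ andre with decompose σ (proj₁ andre)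
... | i , v , s , refl , ∣v∣ , i≤ =
  let (andreS , slot)   = andre-ins⁻ i v s ∣v∣ i≤ andre
      (simsunT , shift) = φᴮ-sound m s andreS
      t                 = φᴮ (suc m) s
  in subst (λ τ → SignedSimsun (suc m) τ × OneAscentLonger (unsigned (ins i v s)) (unsigned τ))
       (sym (φᴮ-ins i v s (proj₁ andreS) ∣v∣ i≤))
       ( simsun-ins⁺ (i ⊓ m) (resign (suc m) v) t (∣resign∣ (suc m) v) (m⊓n≤n i m) simsunT
           (andreSlot→simsunSlot v s t (length-signedPerm t (proj₁ simsunT)) shift slot)
       , oneAscentLonger-step v s t (proj₁ andreS) (proj₁ simsunT) ∣v∣ shift (proj₁ slot))

extract-φᴮ : ∀ {m} (i : ℕ) (v : ℤ) (s : List ℤ) → SignedAndre (suc m) s → ∣ v ∣ ≡ suc (suc m) → i ≤ length s →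
  extract (suc m) (φᴮ (suc (suc m)) (ins i v s)) ≡ (i ⊓ m , resign (suc m) v , φᴮ (suc m) s)
extract-φᴮ {m} i v s andreS ∣v∣ i≤ =
  let permT = proj₁ (proj₁ (φᴮ-sound m s andreS))
      t     = φᴮ (suc m) s
  in trans (cong (extract (suc m)) (φᴮ-ins i v s (proj₁ andreS) ∣v∣ i≤))
       (extract-ins (i ⊓ m) _ t (letters-not-max t permT) (∣resign∣ (suc m) v)
         (subst (i ⊓ m ≤_) (sym (length-signedPerm t permT)) (m⊓n≤n i m)))

-- σ is recovered from φᴮ σ: the image determines i ⊓ m, resign v and φᴮ s, hence
-- i (André positions), v (same absolute value) and s (induction).
φᴮ-injective : (m : ℕ) (σ σ′ : List ℤ) → SignedAndre (suc m) σ → SignedAndre (suc m) σ′ →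
  φᴮ (suc m) σ ≡ φᴮ (suc m) σ′ → σ ≡ σ′
φᴮ-injective zero σ σ′ andre andre′ _ = trans (andre-one σ andre) (sym (andre-one σ′ andre′))
φᴮ-injective (suc m) σ σ′ andre andre′ eq with decompose σ (proj₁ andre) | decompose σ′ (proj₁ andre′)
... | i , v , s , refl , ∣v∣ , i≤ | i′ , v′ , s′ , refl , ∣v′∣ , i′≤
  with andre-ins⁻ i v s ∣v∣ i≤ andre | andre-ins⁻ i′ v′ s′ ∣v′∣ i′≤ andre′
... | andreS , (pos , _) | andreS′ , (pos′ , _) =
  subst (λ k → ins i v s ≡ ins k v′ s′) i≡ (cong₂ (ins i) v≡ s≡)
  where
  images : (i ⊓ m , resign (suc m) v , φᴮ (suc m) s) ≡ (i′ ⊓ m , resign (suc m) v′ , φᴮ (suc m) s′)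
  images = trans (sym (extract-φᴮ i v s andreS ∣v∣ i≤))
             (trans (cong (extract (suc m)) eq) (extract-φᴮ i′ v′ s′ andreS′ ∣v′∣ i′≤))
  i≡ : i ≡ i′
  i≡ = andrePosition-injective pos pos′ (cong proj₁ images)
  v≡ : v ≡ v′
  v≡ = resign-injective v v′ (trans ∣v∣ (sym ∣v′∣)) (cong (λ r → proj₁ (proj₂ r)) images)
  s≡ : s ≡ s′
  s≡ = φᴮ-injective m s s′ andreS andreS′ (cong (λ r → proj₂ (proj₂ r)) images)

-- A Simsun permutation ins j u t has a preimage: take a preimage σ′ of t and insert
-- ±(m+2) at the André slot corresponding to the Simsun slot (j, u).
φᴮ-surjective : (m : ℕ) (τ : List ℤ) → SignedSimsun m τ → ∃ λ σ → SignedAndre (suc m) σ × φᴮ (suc m) σ ≡ τ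
φᴮ-surjective zero τ simsun = + 1 ∷ [] , andre-one-valid , sym (simsun-zero τ simsun)
φᴮ-surjective (suc m) τ simsun with decompose τ (proj₁ simsun)
... | j , u , t , refl , ∣u∣ , j≤ with simsun-ins⁻ j u t ∣u∣ j≤ simsun
... | simsunT , slot with φᴮ-surjective m t simsunT
... | σ′ , andreσ′ , refl =
  let j≤m                  = subst (j ≤_) (length-signedPerm t (proj₁ simsunT)) j≤
      shift                = proj₂ (φᴮ-sound m σ′ andreσ′)
      (i , slotσ′ , i⊓m≡j) = simsunSlot→andreSlot u σ′ t j≤m shift slot
      w                    = resign (suc (suc m)) u
      i≤                   = subst (i ≤_) (sym (length-signedPerm σ′ (proj₁ andreσ′)))
                               (AndrePosition-≤ (proj₁ slotσ′))
  in ins i w σ′ , andre-ins⁺ i w σ′ (∣resign∣ (suc (suc m)) u) andreσ′ slotσ′ ,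
     trans (φᴮ-ins i w σ′ (proj₁ andreσ′) (∣resign∣ (suc (suc m)) u) i≤)
       (cong₂ (λ k x → ins k x t) i⊓m≡j (resign-resign u ∣u∣))

φᴮ-last : (m : ℕ) (σ : List ℤ) → SignedAndre (suc m) σ → Last σ - 1ℤ ≡ Last (φᴮ (suc m) σ)
φᴮ-last zero σ andre rewrite andre-one σ andre = refl
φᴮ-last (suc m) σ andre with decompose σ (proj₁ andre)
... | i , v , s , refl , ∣v∣ , i≤ =
  let (andreS , slot) = andre-ins⁻ i v s ∣v∣ i≤ andre
      permT           = proj₁ (proj₁ (φᴮ-sound m s andreS))
  in trans (last-ins v s (φᴮ (suc m) s) (length-signedPerm s (proj₁ andreS))
               (length-signedPerm _ permT) ∣v∣ slot (φᴮ-last m s andreS))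
       (sym (cong Last (φᴮ-ins i v s (proj₁ andreS) ∣v∣ i≤)))

theorem2p12 : (n : ℕ) → 1 ≤ n →
  Σ (List ℤ → List ℤ) λ φ →
    (∀ σ → SignedAndre n σ → SignedSimsun (n ∸ 1) (φ σ))
    × (∀ σ σ′ → SignedAndre n σ → SignedAndre n σ′ → φ σ ≡ φ σ′ → σ ≡ σ′)
    × (∀ τ → SignedSimsun (n ∸ 1) τ → ∃ λ σ → SignedAndre n σ × φ σ ≡ τ)
    × (∀ σ → SignedAndre n σ → Last σ - 1ℤ ≡ Last (φ σ))
theorem2p12 zero    ()
theorem2p12 (suc m) _ =
  φᴮ (suc m) ,
  (λ σ andre → proj₁ (φᴮ-sound m σ andre)) ,
  φᴮ-injective m ,
  φᴮ-surjective m ,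
  φᴮ-last m
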